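{- Let $n=4m>1$ and let $H$ be an $n\times n$ circulant Hadamard matrix with defining row $H_1=(h_1,\ldots,h_n)$. Then the number of blocks of size $1$ in $H_1$ equals $m$.
   Context: A Hadamard matrix is an $n\times n$ matrix with entries in $\{+1,-1\}$ whose rows are mutually orthogonal. It is circulant if, writing its first row (the defining row) as $H_1=(h_1,\ldots,h_n)$, its $i$-th row is $H_i=(h_{1-i+1},\ldots,h_{n-i+1})$ with subscripts taken modulo $n$. Regard $H_1$ as a circular (cyclic) sequence of $+1$'s and $-1$'s. A block is a maximal set of cyclically consecutive entries of $H_1$ that are all equal; its size $|B|$ is its number of entries. Thus $H_1$ decomposes cyclically into blocks of alternating sign. -}

module Defs where

open import Data.Nat using (ℕ; zero; suc; _+_; _∸_; NonZero)
open import Data.Nat.DivMod using (_%_; m%n<n)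
open import Data.Fin using (Fin; toℕ; fromℕ<)
import Data.Fin as F
open import Data.Integer using (ℤ; +_; -[1+_]; _*_)
import Data.Integer as ℤ
open import Data.Product using (_×_)
open import Data.Sum using (_⊎_)
open import Data.Empty using (⊥)
open import Relation.Binary.PropositionalEquality using (_≡_)
open import Relation.Nullary using (¬_; Dec; yes; no)
open import Data.Bool using (Bool; true; false; _∧_)
open import Relation.Nullary.Decidable using (⌊_⌋; ¬?)

idx : (n : ℕ) → .{{NonZero n}} → ℕ → Fin n
idx n k = fromℕ< (m%n<n k n)

sumℤ : (n : ℕ) → (Fin n → ℤ) → ℤ
sumℤ zero    f = + 0
sumℤ (suc n) f = f F.zero ℤ.+ sumℤ n (λ i → f (F.suc i))

countFin : (n : ℕ) → (Fin n → Bool) → ℕ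
countFin zero    p = 0
countFin (suc n) p with p F.zero
... | true  = suc (countFin n (λ i → p (F.suc i)))
... | false = countFin n (λ i → p (F.suc i))

-- the circulant matrix with (0-indexed) defining row h:
-- entry (i , j) is h_{j - i mod n}  (paper: H_i = (h_{1-i+1},...,h_{n-i+1}))
circ : (n : ℕ) → .{{NonZero n}} → (Fin n → ℤ) → Fin n → Fin n → ℤ
circ n h i j = h (idx n (n + toℕ j ∸ toℕ i))

IsSign : ℤ → Set
IsSign x = (x ≡ + 1) ⊎ (x ≡ -[1+ 0 ])

IsHadamard : (n : ℕ) → (Fin n → Fin n → ℤ) → Set
IsHadamard n H =
  ((i j : Fin n) → IsSign (H i j)) ×
  ((i k : Fin n) → ¬ (i ≡ k) → sumℤ n (λ j → H i j * H k j) ≡ + 0)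

IsCirculantHadamard : (n : ℕ) → .{{NonZero n}} → (Fin n → ℤ) → Set
IsCirculantHadamard n h = IsHadamard n (circ n h)

-- position k forms a block of size 1 (a maximal cyclic run of length 1):
-- its entry differs from both cyclic neighbours
isSingletonBlock : (n : ℕ) → .{{NonZero n}} → (Fin n → ℤ) → Fin n → Bool
isSingletonBlock n h k =
  ⌊ ¬? (h (idx n (n + toℕ k ∸ 1)) ℤ.≟ h k) ⌋ ∧
  ⌊ ¬? (h (idx n (suc (toℕ k))) ℤ.≟ h k) ⌋

numSingletonBlocks : (n : ℕ) → .{{NonZero n}} → (Fin n → ℤ) → ℕ
numSingletonBlocks n h = countFin n (isSingletonBlock n h)

{-# OPTIONS --safe #-}
module Submission where

-- For signs a, b, c one has 4 [a ≠ b ∧ c ≠ b] = 1 - a b - b c + a c. Summing this over the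
-- cyclic triples (h_{t-1}, h_t, h_{t+1}) gives 4 · #(blocks of size 1) = n - 2 C(1) + C(2),
-- where C(s) = Σ_t h_t h_{t+s} is the periodic autocorrelation of the defining row. For
-- 0 < s < n, C(s) is the inner product of two distinct rows of the circulant matrix, hence 0;
-- since n = 4m ≥ 4, this leaves 4 · #(blocks of size 1) = n.

open import Defs
open import Data.Nat using (ℕ; _*_; _<_; NonZero)
open import Data.Fin using (Fin)
open import Data.Integer using (ℤ)
open import Relation.Binary.PropositionalEquality using (_≡_)

open import Data.Bool using (Bool; true; false; _∧_)
import Data.Fin as Fin
open import Data.Fin using (toℕ; fromℕ<)
import Data.Fin.Properties as Finₚ
open import Data.Integer using (+_)
import Data.Integer as ℤ
import Data.Integer.Properties as ℤₚ
open import Algebra.Properties.AbelianGroup ℤₚ.+-0-abelianGroup using (∙-cancelˡ)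
open import Algebra.Properties.CommutativeMonoid.Sum ℤₚ.+-0-commutativeMonoid
  using (sum; sum-cong-≗; sum-init-last; ∑-distrib-+)
open import Algebra.Properties.Semiring.Sum ℤₚ.+-*-semiring using (*-distribˡ-sum)
open import Data.Nat using (zero; suc; _+_; _∸_; _≤_; s≤s)
open import Data.Nat.DivMod using ([m+n]%n≡m%n; m<n⇒m%n≡m)
import Data.Nat.Properties as ℕₚ
open import Data.Product using (proj₁; proj₂)
open import Data.Sum using (inj₁; inj₂)
open import Function using (_∘_)
open import Relation.Binary.PropositionalEquality
  using (_≢_; refl; sym; trans; cong; cong₂; subst; module ≡-Reasoning)
open import Relation.Nullary.Decidable using (⌊_⌋; ¬?)

sumℤ≡sum : ∀ n (f : Fin n → ℤ) → sumℤ n f ≡ sum f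
sumℤ≡sum zero    f = refl
sumℤ≡sum (suc n) f = cong (λ x → f Fin.zero ℤ.+ x) (sumℤ≡sum n (f ∘ Fin.suc))

indicator : Bool → ℤ
indicator true  = + 1
indicator false = + 0

countFin≡sum : ∀ n (p : Fin n → Bool) → + countFin n p ≡ sum (indicator ∘ p)
countFin≡sum zero    p = refl
countFin≡sum (suc n) p with p Fin.zero
... | true  = cong (λ x → + 1 ℤ.+ x) (countFin≡sum n (p ∘ Fin.suc))
... | false = trans (countFin≡sum n (p ∘ Fin.suc)) (sym (ℤₚ.+-identityˡ _))

∑< : ℕ → (ℕ → ℤ) → ℤ
∑< n F = sum {n} (F ∘ toℕ)

∑<-cong : ∀ n {F G : ℕ → ℤ} → (∀ t → F t ≡ G t) → ∑< n F ≡ ∑< n G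
∑<-cong n {F} {G} F≗G = sum-cong-≗ {n} {F ∘ toℕ} {G ∘ toℕ} (λ i → F≗G (toℕ i))

∑<-const : ∀ n → ∑< n (λ _ → + 1) ≡ + n
∑<-const zero    = refl
∑<-const (suc n) = cong (λ x → + 1 ℤ.+ x) (∑<-const n)

∑<-suc : ∀ n F → ∑< (suc n) F ≡ ∑< n F ℤ.+ F n
∑<-suc n F = trans (sum-init-last {n} (F ∘ toℕ))
  (cong₂ ℤ._+_ (sum-cong-≗ {n} (λ i → cong F (Finₚ.toℕ-inject₁ i)))
               (cong F (Finₚ.toℕ-fromℕ n)))

∑<-rotate₁ : ∀ n F → F n ≡ F 0 → ∑< n (F ∘ suc) ≡ ∑< n F
∑<-rotate₁ n F Fn≡F0 = ∙-cancelˡ (F 0) (∑< n (F ∘ suc)) (∑< n F) (begin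
  F 0 ℤ.+ ∑< n (F ∘ suc)  ≡⟨ ∑<-suc n F ⟩
  ∑< n F ℤ.+ F n          ≡⟨ cong (λ x → ∑< n F ℤ.+ x) Fn≡F0 ⟩
  ∑< n F ℤ.+ F 0          ≡⟨ ℤₚ.+-comm (∑< n F) (F 0) ⟩
  F 0 ℤ.+ ∑< n F          ∎)
  where open ≡-Reasoning

∑<-+ : ∀ n F G → ∑< n (λ t → F t ℤ.+ G t) ≡ ∑< n F ℤ.+ ∑< n G
∑<-+ n F G = ∑-distrib-+ {n} (F ∘ toℕ) (G ∘ toℕ)

Periodic : {A : Set} → ℕ → (ℕ → A) → Set
Periodic n F = ∀ t → F (t + n) ≡ F t

∑<-rotate : ∀ n {F} → Periodic n F → ∀ a → ∑< n (λ t → F (a + t)) ≡ ∑< n F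
∑<-rotate n     per zero    = refl
∑<-rotate n {F} per (suc a) =
  trans (∑<-rotate n (per ∘ suc) a) (∑<-rotate₁ n F (per 0))

autocorrelation : ℕ → (ℕ → ℤ) → ℕ → ℤ
autocorrelation n g s = ∑< n (λ t → g t ℤ.* g (s + t))

autocorrelation-rotate : ∀ n {g} → Periodic n g → ∀ a s →
  ∑< n (λ t → g (a + t) ℤ.* g (s + (a + t))) ≡ autocorrelation n g s
autocorrelation-rotate n {g} per a s = ∑<-rotate n per-summand a
  where
  per-summand : Periodic n (λ t → g t ℤ.* g (s + t))
  per-summand t =
    cong₂ ℤ._*_ (per t) (trans (cong g (sym (ℕₚ.+-assoc s t n))) (per (s + t)))

isolated : ℤ → ℤ → ℤ → Bool
isolated a b c = ⌊ ¬? (a ℤ.≟ b) ⌋ ∧ ⌊ ¬? (c ℤ.≟ b) ⌋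

-- For signs, 2 [a ≠ b] = 1 - a b, and 4 [a ≠ b] [c ≠ b] = (1 - a b) (1 - c b).
isolated-identity : ∀ {a b c} → IsSign a → IsSign b → IsSign c →
  + 4 ℤ.* indicator (isolated a b c) ℤ.+ (a ℤ.* b ℤ.+ b ℤ.* c) ≡ + 1 ℤ.+ a ℤ.* c
isolated-identity (inj₁ refl) (inj₁ refl) (inj₁ refl) = refl
isolated-identity (inj₁ refl) (inj₁ refl) (inj₂ refl) = refl
isolated-identity (inj₁ refl) (inj₂ refl) (inj₁ refl) = refl
isolated-identity (inj₁ refl) (inj₂ refl) (inj₂ refl) = refl
isolated-identity (inj₂ refl) (inj₁ refl) (inj₁ refl) = refl
isolated-identity (inj₂ refl) (inj₁ refl) (inj₂ refl) = refl
isolated-identity (inj₂ refl) (inj₂ refl) (inj₁ refl) = refl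
isolated-identity (inj₂ refl) (inj₂ refl) (inj₂ refl) = refl

idx-periodic : ∀ n .{{_ : NonZero n}} → Periodic n (idx n)
idx-periodic n t = Finₚ.fromℕ<-cong _ _ ([m+n]%n≡m%n t n) _ _

idx-toℕ : ∀ {n} .{{_ : NonZero n}} (i : Fin n) → idx n (toℕ i) ≡ i
idx-toℕ i = trans (Finₚ.fromℕ<-cong _ _ (m<n⇒m%n≡m (Finₚ.toℕ<n i)) _ (Finₚ.toℕ<n i))
                  (Finₚ.fromℕ<-toℕ i _)

m+n∸[m∸o]≡o+n : ∀ m n {o} → o ≤ m → m + n ∸ (m ∸ o) ≡ o + n
m+n∸[m∸o]≡o+n m n {o} o≤m =
  trans (ℕₚ.+-∸-comm n (ℕₚ.m∸n≤m m o)) (cong (_+ n) (ℕₚ.m∸[m∸n]≡n o≤m))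

module CirculantHadamard {p : ℕ} (h : Fin (suc p) → ℤ)
                         (hadamard : IsCirculantHadamard (suc p) h) where

  n : ℕ
  n = suc p

  g : ℕ → ℤ
  g t = h (idx n t)

  g-periodic : Periodic n g
  g-periodic = cong h ∘ idx-periodic n

  g[n+t]≡g[t] : ∀ t → g (n + t) ≡ g t
  g[n+t]≡g[t] t = trans (cong g (ℕₚ.+-comm n t)) (g-periodic t)

  g[toℕ]≡h : ∀ i → g (toℕ i) ≡ h i
  g[toℕ]≡h = cong h ∘ idx-toℕ

  zero-row : ∀ j → circ n h Fin.zero j ≡ g (toℕ j)
  zero-row j = g[n+t]≡g[t] (toℕ j)

  g-sign : ∀ t → IsSign (g t)
  g-sign t = subst IsSign (trans (zero-row i) (g[toℕ]≡h i)) (proj₁ hadamard Fin.zero i)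
    where i = idx n t

  -- Row n ∸ (s + 1) of the circulant matrix is row 0 shifted by s + 1.
  autocorrelation-vanishes : ∀ s → suc s < n → autocorrelation n g (suc s) ≡ + 0
  autocorrelation-vanishes s 1+s<n@(s≤s s<p) = begin
    autocorrelation n g (suc s)
      ≡⟨ sum-cong-≗ {n} (λ j → sym (cong₂ ℤ._*_ (zero-row j) (shifted-row j))) ⟩
    sum product
      ≡⟨ sym (sumℤ≡sum n product) ⟩
    sumℤ n product
      ≡⟨ proj₂ hadamard Fin.zero k zero≢k ⟩
    + 0 ∎
    where
    open ≡-Reasoning
    p∸s<n : p ∸ s < n
    p∸s<n = s≤s (ℕₚ.m∸n≤m p s)
    k : Fin n
    k = fromℕ< p∸s<n
    product : Fin n → ℤ
    product j = circ n h Fin.zero j ℤ.* circ n h k j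
    shifted-row : ∀ j → circ n h k j ≡ g (suc s + toℕ j)
    shifted-row j = cong g (trans (cong (λ r → n + toℕ j ∸ r) (Finₚ.toℕ-fromℕ< p∸s<n))
                                  (m+n∸[m∸o]≡o+n n (toℕ j) (ℕₚ.<⇒≤ 1+s<n)))
    zero≢k : Fin.zero ≢ k
    zero≢k 0≡k = ℕₚ.<-irrefl (trans (cong toℕ 0≡k) (Finₚ.toℕ-fromℕ< p∸s<n))
                             (ℕₚ.m<n⇒0<n∸m s<p)

  g₋₁g₀ g₀g₁ g₋₁g₁ : ℕ → ℤ
  g₋₁g₀ t = g (p + t) ℤ.* g t
  g₀g₁  t = g t ℤ.* g (suc t)
  g₋₁g₁ t = g (p + t) ℤ.* g (suc t)

  four-blocks : ℕ → ℤ
  four-blocks t = + 4 ℤ.* indicator (isolated (g (p + t)) (g t) (g (suc t)))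

  -- The predecessor index n + t ∸ 1 of isSingletonBlock reduces to p + t.
  four-blocks-as-sum : + 4 ℤ.* + numSingletonBlocks n h ≡ ∑< n four-blocks
  four-blocks-as-sum = begin
    + 4 ℤ.* + numSingletonBlocks n h
      ≡⟨ cong (+ 4 ℤ.*_) (countFin≡sum n (isSingletonBlock n h)) ⟩
    + 4 ℤ.* sum (indicator ∘ isSingletonBlock n h)
      ≡⟨ *-distribˡ-sum (+ 4) (indicator ∘ isSingletonBlock n h) ⟩
    sum (λ i → + 4 ℤ.* indicator (isSingletonBlock n h i))
      ≡⟨ sum-cong-≗ {n} (λ i → cong (λ b → + 4 ℤ.* indicator
           (isolated (g (p + toℕ i)) b (g (suc (toℕ i))))) (sym (g[toℕ]≡h i))) ⟩
    ∑< n four-blocks ∎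
    where open ≡-Reasoning

  summed-isolated-identity :
    ∑< n four-blocks ℤ.+ (∑< n g₋₁g₀ ℤ.+ ∑< n g₀g₁) ≡ + n ℤ.+ ∑< n g₋₁g₁
  summed-isolated-identity = begin
    ∑< n four-blocks ℤ.+ (∑< n g₋₁g₀ ℤ.+ ∑< n g₀g₁)
      ≡⟨ cong (λ x → ∑< n four-blocks ℤ.+ x) (∑<-+ n g₋₁g₀ g₀g₁) ⟨
    ∑< n four-blocks ℤ.+ ∑< n (λ t → g₋₁g₀ t ℤ.+ g₀g₁ t)
      ≡⟨ ∑<-+ n four-blocks (λ t → g₋₁g₀ t ℤ.+ g₀g₁ t) ⟨
    ∑< n (λ t → four-blocks t ℤ.+ (g₋₁g₀ t ℤ.+ g₀g₁ t))
      ≡⟨ ∑<-cong n (λ t → isolated-identity (g-sign (p + t)) (g-sign t) (g-sign (suc t))) ⟩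
    ∑< n (λ t → + 1 ℤ.+ g₋₁g₁ t)
      ≡⟨ ∑<-+ n (λ _ → + 1) g₋₁g₁ ⟩
    ∑< n (λ _ → + 1) ℤ.+ ∑< n g₋₁g₁
      ≡⟨ cong (ℤ._+ ∑< n g₋₁g₁) (∑<-const n) ⟩
    + n ℤ.+ ∑< n g₋₁g₁ ∎
    where open ≡-Reasoning

  ∑g₀g₁≡0 : 2 < n → ∑< n g₀g₁ ≡ + 0
  ∑g₀g₁≡0 2<n = autocorrelation-vanishes 0 (ℕₚ.<⇒≤ 2<n)

  ∑g₋₁g₀≡0 : 2 < n → ∑< n g₋₁g₀ ≡ + 0
  ∑g₋₁g₀≡0 2<n = begin
    ∑< n g₋₁g₀
      ≡⟨ ∑<-cong n (λ t → cong (g (p + t) ℤ.*_) (g[n+t]≡g[t] t)) ⟨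
    ∑< n (λ t → g (p + t) ℤ.* g (1 + (p + t)))
      ≡⟨ autocorrelation-rotate n g-periodic p 1 ⟩
    autocorrelation n g 1
      ≡⟨ ∑g₀g₁≡0 2<n ⟩
    + 0 ∎
    where open ≡-Reasoning

  ∑g₋₁g₁≡0 : 2 < n → ∑< n g₋₁g₁ ≡ + 0
  ∑g₋₁g₁≡0 2<n = begin
    ∑< n g₋₁g₁
      ≡⟨ ∑<-cong n (λ t → cong (g (p + t) ℤ.*_) (g[n+t]≡g[t] (suc t))) ⟨
    ∑< n (λ t → g (p + t) ℤ.* g (suc (p + suc t)))
      ≡⟨ ∑<-cong n (λ t → cong (λ r → g (p + t) ℤ.* g (suc r)) (ℕₚ.+-suc p t)) ⟩
    ∑< n (λ t → g (p + t) ℤ.* g (2 + (p + t)))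
      ≡⟨ autocorrelation-rotate n g-periodic p 2 ⟩
    autocorrelation n g 2
      ≡⟨ autocorrelation-vanishes 1 2<n ⟩
    + 0 ∎
    where open ≡-Reasoning

  4*numSingletonBlocks≡n : 2 < n → 4 * numSingletonBlocks n h ≡ n
  4*numSingletonBlocks≡n 2<n = ℤₚ.+-injective (begin
    + (4 * numSingletonBlocks n h)
      ≡⟨ ℤₚ.pos-* 4 (numSingletonBlocks n h) ⟩
    + 4 ℤ.* + numSingletonBlocks n h
      ≡⟨ four-blocks-as-sum ⟩
    ∑< n four-blocks
      ≡⟨ ℤₚ.+-identityʳ _ ⟨
    ∑< n four-blocks ℤ.+ (+ 0 ℤ.+ + 0)
      ≡⟨ cong (λ x → ∑< n four-blocks ℤ.+ x) (cong₂ ℤ._+_ (∑g₋₁g₀≡0 2<n) (∑g₀g₁≡0 2<n)) ⟨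
    ∑< n four-blocks ℤ.+ (∑< n g₋₁g₀ ℤ.+ ∑< n g₀g₁)
      ≡⟨ summed-isolated-identity ⟩
    + n ℤ.+ ∑< n g₋₁g₁
      ≡⟨ cong (λ x → + n ℤ.+ x) (∑g₋₁g₁≡0 2<n) ⟩
    + n ℤ.+ + 0
      ≡⟨ ℤₚ.+-identityʳ (+ n) ⟩
    + n ∎)
    where open ≡-Reasoning

lemma2 : (n m : ℕ) → .{{_ : NonZero n}} → n ≡ 4 * m → 1 < n →
    (h : Fin n → ℤ) → IsCirculantHadamard n h →
    numSingletonBlocks n h ≡ m
lemma2 zero    _       _     ()  _ _
lemma2 (suc p) zero    ()    _   _ _
lemma2 (suc p) (suc m) n≡4m  _   h hadamard = ℕₚ.*-cancelˡ-≡ _ _ 4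
  (trans (CirculantHadamard.4*numSingletonBlocks≡n h hadamard 2<n) n≡4m)
  where
  2<n : 2 < suc p
  2<n = ℕₚ.<⇒≤ (subst (4 ≤_) (sym n≡4m) (ℕₚ.m≤m*n 4 (suc m)))
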